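{- Let $G$ be a finite simple graph with vertices $v_1,\dots,v_n$ such that no vertex of $G$ is adjacent to all other vertices, and let $d$ be a positive integer. Let $G'$ be the graph with vertex set consisting of top vertices $t_1,\dots,t_d$, middle vertices $m_1,\dots,m_n$, and bottom vertices $b_{i,j}$ for $1\le i\le n$, $1\le j\le n+1$, whose edges are: all pairs of distinct top vertices; all pairs of distinct bottom vertices; all pairs $t_i m_j$; and $m_i b_{j,k}$ exactly when $i=j$ or $v_iv_j$ is an edge of $G$; there are no other edges. Let $h=n(n+1)+d$. Suppose $G'$ has Hadwiger number at least $h$, and let $S_1,\dots,S_h$ be pairwise disjoint vertex sets of $G'$, each inducing a connected subgraph, such that every two of them are joined by an edge of $G'$. Then each $S_i$ contains exactly one non-middle (i.e. top or bottom) vertex, and each non-middle vertex of $G'$ belongs to exactly one $S_i$.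
   Context: The Hadwiger number of a graph is the largest $h$ such that $K_h$ is a minor of it, equivalently the largest number of pairwise disjoint connected vertex subsets that are pairwise joined by edges. -}

module Defs where

open import Level using (0ℓ)
open import Data.Nat using (ℕ; suc; _+_; _*_; _≥_)
open import Data.Fin using (Fin)
open import Data.Product using (Σ; ∃; _×_; _,_)
open import Data.Sum using (_⊎_)
open import Data.Empty using (⊥)
open import Data.Unit using (⊤)
open import Relation.Nullary using (¬_)
open import Relation.Binary.PropositionalEquality using (_≡_; _≢_)

record SimpleGraph (V : Set) : Set₁ where
  field
    Adj    : V → V → Set
    sym    : ∀ {x y} → Adj x y → Adj y x
    irrefl : ∀ {x} → ¬ Adj x x
open SimpleGraph public

VSet : Set → Set₁
VSet V = V → Set

data WalkIn {V : Set} (G : SimpleGraph V) (S : VSet V) : V → V → Set where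
  here : ∀ {x} → S x → WalkIn G S x x
  step : ∀ {x y z} → S x → Adj G x y → WalkIn G S y z → WalkIn G S x z

Connected : {V : Set} → SimpleGraph V → VSet V → Set
Connected G S = (∃ λ x → S x) × (∀ x y → S x → S y → WalkIn G S x y)

Touch : {V : Set} → SimpleGraph V → VSet V → VSet V → Set
Touch G S T = ∃ λ x → ∃ λ y → S x × T y × Adj G x y

IsCliqueMinorModel : {V : Set} → SimpleGraph V → (h : ℕ) → (Fin h → VSet V) → Set
IsCliqueMinorModel G h S =
    (∀ i → Connected G (S i))
  × (∀ i j x → S i x → S j x → i ≡ j)
  × (∀ i j → i ≢ j → Touch G (S i) (S j))

HadwigerAtLeast : {V : Set} → SimpleGraph V → ℕ → Set₁
HadwigerAtLeast G h = Σ (Fin h → VSet _) λ S → IsCliqueMinorModel G h S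

-- Vertices of G': top t_i (i < d), middle m_i (i < n), bottom b_{i,j} (i < n, j < n+1).
data V' (n d : ℕ) : Set where
  top : Fin d → V' n d
  mid : Fin n → V' n d
  bot : Fin n → Fin (suc n) → V' n d

module _ {n d : ℕ} (G : SimpleGraph (Fin n)) where

  AdjG' : V' n d → V' n d → Set
  AdjG' (top i)   (top j)   = i ≢ j
  AdjG' (top i)   (mid j)   = ⊤
  AdjG' (top i)   (bot j k) = ⊥
  AdjG' (mid i)   (top j)   = ⊤
  AdjG' (mid i)   (mid j)   = ⊥
  AdjG' (mid i)   (bot j k) = (i ≡ j) ⊎ Adj G i j
  AdjG' (bot i k) (top j)   = ⊥
  AdjG' (bot j k) (mid i)   = (i ≡ j) ⊎ Adj G i j
  AdjG' (bot i k) (bot j l) = ¬ ((i ≡ j) × (k ≡ l))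

  private
    sym' : ∀ {x y} → AdjG' x y → AdjG' y x
    sym' {top i}   {top j}   p q = p (Relation.Binary.PropositionalEquality.sym q)
    sym' {top i}   {mid j}   p = p
    sym' {mid i}   {top j}   p = p
    sym' {mid i}   {bot j k} p = p
    sym' {bot j k} {mid i}   p = p
    sym' {bot i k} {bot j l} p (Relation.Binary.PropositionalEquality.refl , Relation.Binary.PropositionalEquality.refl) =
      p (Relation.Binary.PropositionalEquality.refl , Relation.Binary.PropositionalEquality.refl)

    irrefl' : ∀ {x} → ¬ AdjG' x x
    irrefl' {top i}   p = p Relation.Binary.PropositionalEquality.refl
    irrefl' {mid i}   ()
    irrefl' {bot i k} p = p (Relation.Binary.PropositionalEquality.refl , Relation.Binary.PropositionalEquality.refl)

  G' : SimpleGraph (V' n d)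
  G' = record { Adj = AdjG' ; sym = sym' ; irrefl = irrefl' }

NonMiddle : {n d : ℕ} → V' n d → Set
NonMiddle (top _)   = ⊤
NonMiddle (mid _)   = ⊥
NonMiddle (bot _ _) = ⊤

module Submission where

-- Let h = n(n+1) + d.  The graph G' has exactly h non-middle vertices
-- (d top and n(n+1) bottom ones), and the proof is a counting argument.
--
--   1. Every branch set S_i contains a non-middle vertex.  Middle vertices
--      are pairwise non-adjacent, so a connected set without non-middle
--      vertices is a single middle vertex m_a.  Every other branch set then
--      touches m_a, hence contains a non-middle neighbour of m_a.  Together
--      with one bottom vertex b_{w,0}, where w is a vertex that a is not
--      adjacent to, this gives an injection of the h branch sets into the h
--      non-middle vertices which misses b_{w,1}: impossible.
--   2. Choosing such a vertex in every branch set is injective (the branch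
--      sets are disjoint), hence a bijection onto the non-middle vertices;
--      both claims of the theorem follow.
--
-- Both counting steps use one pigeonhole principle: an injection from
-- Fin h into the non-middle vertices is onto.

open import Defs hiding (sym)
open import Data.Nat using (ℕ; zero; suc; _+_; _*_; _≥_)
open import Data.Nat.Properties using (<-irrefl)
open import Data.Fin using (Fin; _↑ˡ_; _↑ʳ_; combine; remQuot; splitAt; punchOut; _≟_)
  renaming (zero to fzero; suc to fsuc)
open import Data.Fin.Properties using (splitAt-↑ˡ; splitAt-↑ʳ; remQuot-combine; punchOut-injective; injective⇒≤; any?)
open import Data.Product using (∃; _×_; _,_; proj₁; proj₂; uncurry)
open import Data.Sum using (_⊎_; inj₁; inj₂; [_,_]′)
open import Data.Empty using (⊥-elim)
open import Data.Unit using (tt)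
open import Function using (_∘_)
open import Relation.Nullary using (¬_; yes; no)
open import Relation.Binary.PropositionalEquality using (_≡_; _≢_; refl; sym; trans; cong; subst)

-- An injective endofunction of a finite set is surjective: otherwise
-- punching out a missed value injects Fin (suc m) into Fin m.
fin-injective⇒surjective : ∀ {m} (f : Fin m → Fin m) → (∀ {x y} → f x ≡ f y → x ≡ y)
  → ∀ t → ∃ λ z → f z ≡ t
fin-injective⇒surjective {suc m} f f-inj t with any? (λ z → f z ≟ t)
... | yes hit = hit
... | no miss = ⊥-elim (<-irrefl refl (injective⇒≤ {f = squeeze} squeeze-inj))
  where
  avoids : ∀ z → t ≢ f z
  avoids z e = miss (z , sym e)
  squeeze : Fin (suc m) → Fin m
  squeeze z = punchOut (avoids z)
  squeeze-inj : ∀ {x y} → squeeze x ≡ squeeze y → x ≡ y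
  squeeze-inj {x} {y} e = f-inj (punchOut-injective (avoids x) (avoids y) e)

escape-or-all : ∀ {m} {A : Set} {B : Fin m → Set} → (∀ j → A ⊎ B j) → A ⊎ (∀ j → B j)
escape-or-all {zero} f = inj₂ (λ ())
escape-or-all {suc m} f with f fzero | escape-or-all (λ j → f (fsuc j))
... | inj₁ a | _      = inj₁ a
... | inj₂ _ | inj₁ a = inj₁ a
... | inj₂ b | inj₂ g = inj₂ λ { fzero → b ; (fsuc j) → g j }

walk-start : ∀ {V} {G : SimpleGraph V} {T x y} → WalkIn G T x y → T x
walk-start (here s)     = s
walk-start (step s _ _) = s

module _ {n d : ℕ} where

  encode : (x : V' n d) → NonMiddle x → Fin (n * suc n + d)
  encode (top t)   _ = (n * suc n) ↑ʳ t
  encode (bot i k) _ = combine i k ↑ˡ d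

  decode : Fin (n * suc n + d) → V' n d
  decode = decode-part ∘ splitAt (n * suc n)
    where
    decode-part : Fin (n * suc n) ⊎ Fin d → V' n d
    decode-part = [ uncurry bot ∘ remQuot (suc n) , top ]′

  decode-encode : ∀ x p → decode (encode x p) ≡ x
  decode-encode (top t)   _ rewrite splitAt-↑ʳ (n * suc n) d t = refl
  decode-encode (bot i k) _ rewrite splitAt-↑ˡ (n * suc n) (combine i k) d =
    cong (uncurry bot) (remQuot-combine i k)

  encode-injective : ∀ x y p q → encode x p ≡ encode y q → x ≡ y
  encode-injective x y p q e =
    trans (sym (decode-encode x p)) (trans (cong decode e) (decode-encode y q))

  nonMiddle-pigeonhole : (g : Fin (n * suc n + d) → V' n d) → (∀ i → NonMiddle (g i))
    → (∀ {i j} → g i ≡ g j → i ≡ j)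
    → ∀ x → NonMiddle x → ∃ λ i → g i ≡ x
  nonMiddle-pigeonhole g nm g-inj x p with fin-injective⇒surjective code code-inj (encode x p)
    where
    code : Fin (n * suc n + d) → Fin (n * suc n + d)
    code i = encode (g i) (nm i)
    code-inj : ∀ {i j} → code i ≡ code j → i ≡ j
    code-inj e = g-inj (encode-injective _ _ _ _ e)
  ... | i , e = i , encode-injective _ x _ p e

  module _ (G : SimpleGraph (Fin n)) where

    middle-neighbour-nonMiddle : ∀ {a} y → Adj (G' {n} {d} G) (mid a) y → NonMiddle y
    middle-neighbour-nonMiddle (top _)   _ = tt
    middle-neighbour-nonMiddle (bot _ _) _ = tt

    -- Middle vertices are pairwise non-adjacent, so a walk inside T between
    -- two distinct middle vertices must pass through a non-middle vertex of T.
    middle-walk : ∀ {T a c} → WalkIn (G' {n} {d} G) T (mid a) (mid c)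
      → (a ≡ c) ⊎ (∃ λ x → NonMiddle x × T x)
    middle-walk (here _) = inj₁ refl
    middle-walk (step {y = y} _ adj w) = inj₂ (y , middle-neighbour-nonMiddle y adj , walk-start w)

module CliqueModel (n d : ℕ) (G : SimpleGraph (Fin n))
  (no-dominating : ∀ v → ∃ λ w → (w ≢ v) × ¬ Adj G v w)
  (S : Fin (n * suc n + d) → VSet (V' n d))
  (model : IsCliqueMinorModel (G' {n} {d} G) (n * suc n + d) S) where

  h : ℕ
  h = n * suc n + d

  connected : ∀ i → Connected (G' {n} {d} G) (S i)
  connected = proj₁ model

  disjoint : ∀ i j x → S i x → S j x → i ≡ j
  disjoint = proj₁ (proj₂ model)

  touching : ∀ i j → i ≢ j → Touch (G' {n} {d} G) (S i) (S j)
  touching = proj₂ (proj₂ model)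

  HasNonMiddle : Fin h → Set
  HasNonMiddle i = ∃ λ x → NonMiddle x × S i x

  NeighbourIn : Fin n → Fin h → Set
  NeighbourIn a j = ∃ λ y → S j y × Adj (G' {n} {d} G) (mid a) y

  touch-middle : ∀ i a → S i (mid a) → ∀ j → HasNonMiddle i ⊎ ((j ≡ i) ⊎ NeighbourIn a j)
  touch-middle i a sa j with j ≟ i
  ... | yes j≡i = inj₂ (inj₁ j≡i)
  ... | no j≢i with touching i j (λ i≡j → j≢i (sym i≡j))
  ... | top t   , _ , sx , _  , _   = inj₁ (top t , tt , sx)
  ... | bot p q , _ , sx , _  , _   = inj₁ (bot p q , tt , sx)
  ... | mid c   , y , sx , sy , adj with middle-walk G (proj₂ (connected i) (mid a) (mid c) sa sx)
  ...   | inj₂ found = inj₁ found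
  ...   | inj₁ refl  = inj₂ (inj₂ (y , sy , adj))

  -- It cannot happen that every other branch set contains a neighbour of
  -- m_a: with w a non-neighbour of a, assigning b_{w,0} to S_i and the chosen
  -- neighbour to every other S_j is injective but misses b_{w,1}.
  not-all-neighbours : ∀ i a → ¬ (∀ j → (j ≡ i) ⊎ NeighbourIn a j)
  not-all-neighbours i a choice =
    let j , hit = nonMiddle-pigeonhole pick pick-nonMiddle pick-injective (bot w (fsuc w)) tt
    in misses j (choice j) hit
    where
    w : Fin n
    w = proj₁ (no-dominating a)

    far : ∀ k → ¬ Adj (G' {n} {d} G) (mid a) (bot w k)
    far k = [ (λ a≡w → proj₁ (proj₂ (no-dominating a)) (sym a≡w)) , proj₂ (proj₂ (no-dominating a)) ]′

    pick′ : ∀ j → (j ≡ i) ⊎ NeighbourIn a j → V' n d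
    pick′ j (inj₁ _)       = bot w fzero
    pick′ j (inj₂ (y , _)) = y

    pick : Fin h → V' n d
    pick j = pick′ j (choice j)

    pick-nonMiddle : ∀ j → NonMiddle (pick j)
    pick-nonMiddle j with choice j
    ... | inj₁ _             = tt
    ... | inj₂ (y , _ , adj) = middle-neighbour-nonMiddle G y adj

    pick′-injective : ∀ j k cj ck → pick′ j cj ≡ pick′ k ck → j ≡ k
    pick′-injective j k (inj₁ j≡i) (inj₁ k≡i) _ = trans j≡i (sym k≡i)
    pick′-injective j k (inj₁ _) (inj₂ (_ , _ , adj)) refl = ⊥-elim (far fzero adj)
    pick′-injective j k (inj₂ (_ , _ , adj)) (inj₁ _) refl = ⊥-elim (far fzero adj)
    pick′-injective j k (inj₂ (y , sj , _)) (inj₂ (_ , sk , _)) refl = disjoint j k y sj sk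

    pick-injective : ∀ {j k} → pick j ≡ pick k → j ≡ k
    pick-injective {j} {k} = pick′-injective j k (choice j) (choice k)

    misses : ∀ j cj → pick′ j cj ≢ bot w (fsuc w)
    misses j (inj₁ _) ()
    misses j (inj₂ (_ , _ , adj)) refl = far (fsuc w) adj

  hasNonMiddle : ∀ i → HasNonMiddle i
  hasNonMiddle i with proj₁ (connected i)
  ... | top t   , s = top t , tt , s
  ... | bot p q , s = bot p q , tt , s
  ... | mid a   , s with escape-or-all (touch-middle i a s)
  ...   | inj₁ found = found
  ...   | inj₂ all   = ⊥-elim (not-all-neighbours i a all)

  representative : Fin h → V' n d
  representative i = proj₁ (hasNonMiddle i)

  representative-nonMiddle : ∀ i → NonMiddle (representative i)
  representative-nonMiddle i = proj₁ (proj₂ (hasNonMiddle i))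

  representative-∈ : ∀ i → S i (representative i)
  representative-∈ i = proj₂ (proj₂ (hasNonMiddle i))

  representative-onto : ∀ x → NonMiddle x → ∃ λ i → representative i ≡ x
  representative-onto = nonMiddle-pigeonhole representative
    representative-nonMiddle
    (λ {i} {j} e → disjoint i j _ (subst (S i) e (representative-∈ i)) (representative-∈ j))

  -- Hence the representative is the only non-middle vertex of its set:
  -- any other one represents some S_k, which then meets S_i.
  nonMiddle-∈-unique : ∀ i y → NonMiddle y → S i y → y ≡ representative i
  nonMiddle-∈-unique i y p sy with representative-onto y p
  ... | k , refl with disjoint k i y (representative-∈ k) sy
  ... | refl = refl

lemma3 : (n d : ℕ) → (G : SimpleGraph (Fin n))
    → (∀ v → ∃ λ w → (w ≢ v) × ¬ Adj G v w)
    → d ≥ 1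
    → HadwigerAtLeast (G' {n} {d} G) (n * suc n + d)
    → (S : Fin (n * suc n + d) → VSet (V' n d))
    → IsCliqueMinorModel (G' {n} {d} G) (n * suc n + d) S
    → (∀ i → ∃ λ x → NonMiddle x × S i x × (∀ y → NonMiddle y → S i y → y ≡ x))
    × (∀ x → NonMiddle x → ∃ λ i → S i x × (∀ j → S j x → j ≡ i))
lemma3 n d G no-dominating _ _ S model = exactly-one-per-set , exactly-one-set
  where
  open CliqueModel n d G no-dominating S model

  exactly-one-per-set : ∀ i → ∃ λ x → NonMiddle x × S i x × (∀ y → NonMiddle y → S i y → y ≡ x)
  exactly-one-per-set i =
    representative i , representative-nonMiddle i , representative-∈ i , nonMiddle-∈-unique i

  exactly-one-set : ∀ x → NonMiddle x → ∃ λ i → S i x × (∀ j → S j x → j ≡ i)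
  exactly-one-set x p with representative-onto x p
  ... | i , refl = i , representative-∈ i , λ j sj → disjoint j i x sj (representative-∈ i)
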